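{- Let $n$ be an odd positive integer and let $a\in\mathbb{F}_{2^n}$ be a nonzero element with $\operatorname{tr}\left(\frac{1}{a}\right)=1$. Let $P(x)=x+x^2+\operatorname{tr}\left(\frac{x}{a}\right)\in\mathbb{F}_{2^n}[x]$, which is a linearized permutation polynomial of $\mathbb{F}_{2^n}$. Then its compositional inverse is $$P^{ -1}(x)=B_a(x)+\operatorname{tr}(x),\qquad B_a(x)=\sum_{i=0}^{n-1}b_ix^{2^i},$$ where, writing $c=\frac{1}{a}$, $$b_0=c\langle\{2,4,6,\ldots,n-1\}\rangle,$$ and for $1\le i\le n-1$, $$b_i=\begin{cases} c\langle\{1,3,5,\ldots,i\}\cup\{i+1,i+3,\ldots,n-1\}\rangle & \text{if } i \text{ is odd},\\ c\langle\{1,3,5,\ldots,i-1\}\cup\{i+2,i+4,\ldots,n-1\}\rangle & \text{if } i \text{ is even}.\end{cases}$$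
   Context: $\operatorname{tr}$ denotes the absolute trace of $\mathbb{F}_{2^n}$; as a polynomial, $\operatorname{tr}(x)=\sum_{i=0}^{n-1}x^{2^i}$, and $\operatorname{tr}(x/a)=\sum_{i=0}^{n-1}(x/a)^{2^i}$. For $c\in\mathbb{F}_{2^n}$ and a subset $I\subseteq\{0,1,\ldots,n-1\}$, the notation $c\langle I\rangle$ means $\sum_{i\in I}c^{2^i}$ (an empty set gives $0$); the sets listed are arithmetic progressions with step $2$, empty if the starting value exceeds the end value. The compositional inverse $P^{ -1}$ is the unique polynomial of degree less than $2^n$ with $P(P^{ -1}(x))\equiv P^{ -1}(P(x))\equiv x \pmod{x^{2^n}-x}$. -}

module Defs where

open import Level using (Level; _⊔_) renaming (suc to lsuc)
open import Data.Nat using (ℕ; zero; suc; _∸_; _^_; _≤?_; _≟_)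
import Data.Nat as N
open import Data.Nat.DivMod using (_%_)
open import Data.Fin using (Fin)
open import Data.List using (List; []; _∷_; _++_; upTo; filter; map; foldr)
open import Data.Product using (∃; _×_; _,_)
open import Relation.Nullary using (¬_)
open import Relation.Nullary.Decidable using (_×-dec_)
open import Relation.Binary.PropositionalEquality using (_≡_)
open import Algebra.Bundles using (CommutativeRing)

record GF2^ (n : ℕ) (c ℓ : Level) : Set (lsuc (c ⊔ ℓ)) where
  field
    cring : CommutativeRing c ℓ
  open CommutativeRing cring public
  field
    1≉0     : ¬ (1# ≈ 0#)
    inverse : ∀ x → ¬ (x ≈ 0#) → ∃ λ y → x * y ≈ 1#
    char2   : 1# + 1# ≈ 0#
    enum    : Fin (2 ^ n) → Carrier
    enum-injective  : ∀ i j → enum i ≈ enum j → i ≡ j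
    enum-surjective : ∀ x → ∃ λ i → enum i ≈ x

module _ {n : ℕ} {c ℓ : Level} (F : GF2^ n c ℓ) where
  open GF2^ F

  pow : Carrier → ℕ → Carrier
  pow x zero    = 1#
  pow x (suc k) = x * pow x k

  frob : Carrier → ℕ → Carrier
  frob x i = pow x (2 ^ i)

  sumL : List Carrier → Carrier
  sumL = foldr _+_ 0#

  sumTo : ℕ → (ℕ → Carrier) → Carrier
  sumTo m f = sumL (map f (upTo m))

  tr : Carrier → Carrier
  tr x = sumTo n (λ i → frob x i)

  -- c⟨I⟩ = Σ_{i ∈ I} c^(2^i), I given as a list of (distinct) indices
  bracket : Carrier → List ℕ → Carrier
  bracket z I = sumL (map (frob z) I)

  linPoly : (ℕ → Carrier) → Carrier → Carrier
  linPoly b x = sumTo n (λ i → b i * frob x i)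

-- the arithmetic progression {s, s+2, s+4, ...} ∩ [0, e]
-- (empty if s > e); as a list in increasing order
prog : ℕ → ℕ → List ℕ
prog s e = filter (λ j → (s ≤? j) ×-dec ((j % 2) ≟ (s % 2))) (upTo (suc e))

bIndex : ℕ → ℕ → List ℕ
bIndex n zero = prog 2 (n ∸ 1)
bIndex n (suc k) with (suc k) % 2 ≟ 1
... | Relation.Nullary.yes _ = prog 1 (suc k) ++ prog (suc k N.+ 1) (n ∸ 1)
... | Relation.Nullary.no  _ = prog 1 (suc k ∸ 1) ++ prog (suc k N.+ 2) (n ∸ 1)

-- Consecutive index sets bIndex n i and bIndex n (i+1) differ exactly in the element i+1, so
-- b_{i+1} = b_i + c^(2^(i+1)). Hence Σ b_i = 0 (the terms pair up, leaving b_0 twice) and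
-- b_{n-1} + b_0 = tr c + c = 1 + c. Summation by parts together with y^(2^n) = y then gives
-- B(y) + B(y²) = y + tr(cy). Since t = tr(cy) satisfies t² = t, B(t) = (Σ b_i) t = 0 and, n being
-- odd, tr t = t; with tr(y²) = tr y this yields Q(P y) = y. On a finite field a left inverse is
-- also a right inverse, so P(Q x) = x as well.
module Submission where

open import Defs
open import Level using (Level)
open import Data.Nat using (ℕ; zero; suc; _<_; z≤n; s≤s)
import Data.Nat as ℕ
open import Data.Nat.DivMod using (_%_)
open import Data.List using (foldr; applyUpTo)
open import Data.Product using (∃; _×_; _,_)
open import Function using (_∘_)
open import Algebra.Bundles using (CommutativeSemiring)
open import Relation.Binary.PropositionalEquality using (_≡_)
import Relation.Binary.PropositionalEquality as ≡
open import Data.Fin as Fin using (Fin; punchOut)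
open import Data.Fin.Properties using (any?; punchOut-injective; injective⇒≤)
import Data.Nat.Properties as ℕₚ
open import Relation.Nullary using (¬_; does; yes; no; contradiction)

module IndexSets where
  open import Data.Nat using (_+_; _∸_; _≤_; _≤?_; _≟_)
  open import Data.Nat.Properties
    using (+-suc; +-comm; ≤-refl; ≤-trans; n≤1+n; <⇒≱; ≤∧≢⇒<; m≤n⇒m<n∨m≡n)
  open import Data.List using (List; []; _∷_; _++_; [_]; upTo; filter)
  open import Data.List.Properties using (upTo-∷ʳ; filter-++; filter-accept; filter-reject; ++-identityʳ; ++-assoc)
  open import Data.Product using (proj₁; proj₂)
  open import Data.Sum using (_⊎_; inj₁; inj₂)
  open import Relation.Nullary using (¬_; Dec; yes; no; contradiction)
  open import Relation.Nullary.Decidable using (_×-dec_)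
  open import Relation.Binary.PropositionalEquality using (_≢_; refl; sym; trans; cong; subst)

  data Parity : ℕ → Set where
    zero : Parity 0
    odd  : ∀ j → Parity (suc (j + j))
    even : ∀ j → Parity (suc (suc (j + j)))

  parity : ∀ i → Parity i
  parity zero = zero
  parity (suc i) with parity i
  ... | zero   = odd 0
  ... | odd j  = even j
  ... | even j = subst Parity (cong (λ k → suc (suc k)) (+-suc j j)) (odd (suc j))

  [j+j]%2≡0 : ∀ j → (j + j) % 2 ≡ 0
  [j+j]%2≡0 zero    = refl
  [j+j]%2≡0 (suc j) = trans (cong (λ k → suc k % 2) (+-suc j j)) ([j+j]%2≡0 j)

  [1+j+j]%2≡1 : ∀ j → suc (j + j) % 2 ≡ 1
  [1+j+j]%2≡1 zero    = refl
  [1+j+j]%2≡1 (suc j) = trans (cong (λ k → suc (suc k) % 2) (+-suc j j)) ([1+j+j]%2≡1 j)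

  [2+j+j]%2≢1 : ∀ j → suc (suc (j + j)) % 2 ≢ 1
  [2+j+j]%2≢1 j [j+j]%2≡1 with () ← trans (sym ([j+j]%2≡0 j)) [j+j]%2≡1

  [1+m]%2≢m%2 : ∀ m → suc m % 2 ≢ m % 2
  [1+m]%2≢m%2 zero          ()
  [1+m]%2≢m%2 (suc zero)    ()
  [1+m]%2≢m%2 (suc (suc m)) = [1+m]%2≢m%2 m

  odd⇒≡1+K+K : ∀ n → n % 2 ≡ 1 → ∃ λ K → n ≡ suc (K + K)
  odd⇒≡1+K+K n n%2≡1 with parity n
  odd⇒≡1+K+K _ ()    | zero
  odd⇒≡1+K+K _ _     | odd K  = K , refl
  odd⇒≡1+K+K _ n%2≡1 | even j with () ← trans (sym n%2≡1) ([j+j]%2≡0 j)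

  InProg : ℕ → ℕ → Set
  InProg s j = s ≤ j × j % 2 ≡ s % 2

  inProg? : ∀ s j → Dec (InProg s j)
  inProg? s j = (s ≤? j) ×-dec (j % 2 ≟ s % 2)

  prog-suc : ∀ s e → prog s (suc e) ≡ prog s e ++ filter (inProg? s) [ suc e ]
  prog-suc s e = trans (cong (filter (inProg? s)) (sym (upTo-∷ʳ (suc e))))
                       (filter-++ (inProg? s) (upTo (suc e)) [ suc e ])

  prog-accept : ∀ {s e} → InProg s (suc e) → prog s (suc e) ≡ prog s e ++ [ suc e ]
  prog-accept {s} {e} p = trans (prog-suc s e) (cong (prog s e ++_) (filter-accept (inProg? s) p))

  prog-reject : ∀ {s e} → ¬ InProg s (suc e) → prog s (suc e) ≡ prog s e
  prog-reject {s} {e} ¬p =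
    trans (prog-suc s e) (trans (cong (prog s e ++_) (filter-reject (inProg? s) ¬p)) (++-identityʳ _))

  prog-empty : ∀ {s e} → e < s → prog s e ≡ []
  prog-empty {s} {zero}  0<s = filter-reject (inProg? s) (λ p → <⇒≱ 0<s (proj₁ p))
  prog-empty {s} {suc e} e<s =
    trans (prog-reject (λ p → <⇒≱ e<s (proj₁ p))) (prog-empty (≤-trans (n≤1+n _) e<s))

  prog-cons : ∀ {s e} → s ≤ e → prog s e ≡ s ∷ prog (2 + s) e
  prog-cons {s} s≤e with m≤n⇒m<n∨m≡n s≤e
  prog-cons {zero}  _ | inj₂ refl = refl
  prog-cons {suc s} _ | inj₂ refl = trans (prog-accept {suc s} {s} (≤-refl , refl))
    (trans (cong (_++ [ suc s ]) (prog-empty {suc s} {s} ≤-refl))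
           (cong (suc s ∷_) (sym (prog-empty {3 + s} {suc s} (n≤1+n _)))))
  prog-cons {s} {suc e} s≤1+e | inj₁ (s≤s s≤e) with inProg? s (suc e)
  ... | yes p = trans (prog-accept p)
    (trans (cong (_++ [ suc e ]) (prog-cons s≤e)) (cong (s ∷_) (sym (prog-accept (2+s≤1+e , proj₂ p)))))
    where 2+s≤1+e = s≤s (≤∧≢⇒< s≤e (λ { refl → [1+m]%2≢m%2 s (proj₂ p) }))
  ... | no ¬p = trans (prog-reject {s} {e} ¬p)
    (trans (prog-cons s≤e) (cong (s ∷_) (sym (prog-reject {2 + s} {e} (λ q → ¬p (s≤1+e , proj₂ q))))))

  prog-snoc₂ : ∀ {s e} → s ≤ 2 + e → e % 2 ≡ s % 2 → prog s (2 + e) ≡ prog s e ++ [ 2 + e ]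
  prog-snoc₂ {s} {e} s≤2+e e≡s = trans (prog-accept (s≤2+e , e≡s))
    (cong (_++ [ 2 + e ]) (prog-reject {s} {e} (λ p → [1+m]%2≢m%2 e (trans (proj₂ p) (sym e≡s)))))

  bIndex-odd : ∀ n k → suc k % 2 ≡ 1 → bIndex n (suc k) ≡ prog 1 (suc k) ++ prog (2 + k) (n ∸ 1)
  bIndex-odd n k isOdd with suc k % 2 ≟ 1
  ... | yes _     = cong (λ s → prog 1 (suc k) ++ prog (suc s) (n ∸ 1)) (+-comm k 1)
  ... | no ¬isOdd = contradiction isOdd ¬isOdd

  bIndex-even : ∀ n k → suc k % 2 ≢ 1 → bIndex n (suc k) ≡ prog 1 k ++ prog (3 + k) (n ∸ 1)
  bIndex-even n k ¬isOdd with suc k % 2 ≟ 1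
  ... | yes isOdd = contradiction isOdd ¬isOdd
  ... | no _      = cong (λ s → prog 1 k ++ prog (suc s) (n ∸ 1)) (+-comm k 2)

  Inserts : ℕ → List ℕ → List ℕ → Set
  Inserts x I J = ∃ λ O → ∃ λ E → I ≡ O ++ E × J ≡ O ++ x ∷ E

  bIndex-step : ∀ m i → suc i ≤ m →
    Inserts (suc i) (bIndex (suc m) i) (bIndex (suc m) (suc i)) ⊎
    Inserts (suc i) (bIndex (suc m) (suc i)) (bIndex (suc m) i)
  bIndex-step m i i<m with parity i
  ... | zero   = inj₁ ([] , prog 2 m , refl , refl)
  ... | odd j  = inj₂ (prog 1 (suc (j + j)) , prog (4 + (j + j)) m ,
                       bIndex-even (suc m) (suc (j + j)) ([2+j+j]%2≢1 j) ,
                       trans (bIndex-odd (suc m) (j + j) ([1+j+j]%2≡1 j))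
                             (cong (prog 1 (suc (j + j)) ++_) (prog-cons i<m)))
  ... | even j = inj₁ (prog 1 (suc (j + j)) , prog (4 + (j + j)) m ,
                       bIndex-even (suc m) (suc (j + j)) ([2+j+j]%2≢1 j) ,
                       trans (bIndex-odd (suc m) (suc (suc (j + j))) ([1+j+j]%2≡1 j))
                             (trans (cong (_++ prog (4 + (j + j)) m) (prog-snoc₂ (s≤s z≤n) ([1+j+j]%2≡1 j)))
                                    (++-assoc (prog 1 (suc (j + j))) _ _)))

  prog2-snoc : ∀ L → prog 2 (suc L + suc L) ≡ prog 2 (L + L) ++ [ 2 + (L + L) ]
  prog2-snoc L = trans (cong (λ k → prog 2 (suc k)) (+-suc L L))
                       (prog-snoc₂ (s≤s (s≤s z≤n)) ([j+j]%2≡0 L))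

open IndexSets

injective⇒surjective : ∀ {N} (f : Fin N → Fin N) → (∀ {i j} → f i ≡ f j → i ≡ j) →
                        ∀ j → ∃ λ i → f i ≡ j
injective⇒surjective {N} f f-injective j with any? (λ i → f i Fin.≟ j)
... | yes hit = hit
injective⇒surjective {suc N} f f-injective j | no miss =
  contradiction (injective⇒≤ g-injective) (ℕₚ.<-irrefl ≡.refl)
  where
  g : Fin (suc N) → Fin N
  g i = punchOut {i = j} (λ j≡fi → miss (i , ≡.sym j≡fi))
  g-injective : ∀ {a b} → g a ≡ g b → a ≡ b
  g-injective {a} {b} ga≡gb =
    f-injective (punchOut-injective (λ j≡fa → miss (a , ≡.sym j≡fa)) (λ j≡fb → miss (b , ≡.sym j≡fb)) ga≡gb)

module Sums {c ℓ} (R : CommutativeSemiring c ℓ) where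
  open CommutativeSemiring R
  open import Relation.Binary.Reasoning.Setoid setoid
  open import Algebra.Solver.CommutativeMonoid +-commutativeMonoid using (solve; _⊕_; _⊜_; id)
  open import Algebra.Properties.CommutativeSemigroup +-commutativeSemigroup
    using () renaming (interchange to +-interchange)

  sum< : ℕ → (ℕ → Carrier) → Carrier
  sum< m f = foldr _+_ 0# (applyUpTo f m)

  sum<-cong< : ∀ m {f g} → (∀ i → i < m → f i ≈ g i) → sum< m f ≈ sum< m g
  sum<-cong< zero    f≈g = refl
  sum<-cong< (suc m) f≈g = +-cong (f≈g 0 (s≤s z≤n)) (sum<-cong< m (λ i i<m → f≈g (suc i) (s≤s i<m)))

  sum<-cong : ∀ m {f g} → (∀ i → f i ≈ g i) → sum< m f ≈ sum< m g
  sum<-cong m f≈g = sum<-cong< m (λ i _ → f≈g i)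

  sum<-+ : ∀ m f g → sum< m (λ i → f i + g i) ≈ sum< m f + sum< m g
  sum<-+ zero    f g = sym (+-identityʳ 0#)
  sum<-+ (suc m) f g = trans (+-congˡ (sum<-+ m (f ∘ suc) (g ∘ suc)))
    (+-interchange (f 0) (g 0) _ _)

  sum<-*ʳ : ∀ m f a → sum< m (λ i → f i * a) ≈ sum< m f * a
  sum<-*ʳ zero    f a = sym (zeroˡ a)
  sum<-*ʳ (suc m) f a = trans (+-congˡ (sum<-*ʳ m (f ∘ suc) a)) (sym (distribʳ a (f 0) _))

  sum<-snoc : ∀ m f → sum< (suc m) f ≈ sum< m f + f m
  sum<-snoc zero    f = trans (+-identityʳ (f 0)) (sym (+-identityˡ (f 0)))
  sum<-snoc (suc m) f = trans (+-congˡ (sum<-snoc m (f ∘ suc))) (sym (+-assoc _ _ _))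

  sum<-const-+ : ∀ m p a → sum< (m ℕ.+ p) (λ _ → a) ≈ sum< m (λ _ → a) + sum< p (λ _ → a)
  sum<-const-+ zero    p a = sym (+-identityˡ _)
  sum<-const-+ (suc m) p a = trans (+-congˡ (sum<-const-+ m p a)) (sym (+-assoc _ _ _))

  sum<-pair-shift : ∀ m (b u : ℕ → Carrier) →
    sum< (suc m) (λ i → b i * u i) + sum< (suc m) (λ i → b i * u (suc i))
      ≈ b 0 * u 0 + (sum< m (λ j → (b (suc j) + b j) * u (suc j)) + b m * u (suc m))
  sum<-pair-shift zero    b u =
    solve 2 (λ x y → (x ⊕ id) ⊕ (y ⊕ id) ⊜ x ⊕ (id ⊕ y)) refl (b 0 * u 0) (b 0 * u 1)
  sum<-pair-shift (suc m) b u = begin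
    (b 0 * u 0 + A) + (b 0 * u 1 + B)
      ≈⟨ solve 4 (λ x y p q → (x ⊕ p) ⊕ (y ⊕ q) ⊜ x ⊕ (y ⊕ (p ⊕ q))) refl _ _ A B ⟩
    b 0 * u 0 + (b 0 * u 1 + (A + B))
      ≈⟨ +-congˡ (+-congˡ (sum<-pair-shift m (b ∘ suc) (u ∘ suc))) ⟩
    b 0 * u 0 + (b 0 * u 1 + (b 1 * u 1 + (X + T)))
      ≈⟨ +-congˡ (solve 4 (λ y z x t → y ⊕ (z ⊕ (x ⊕ t)) ⊜ ((z ⊕ y) ⊕ x) ⊕ t) refl _ _ X T) ⟩
    b 0 * u 0 + ((b 1 * u 1 + b 0 * u 1 + X) + T)
      ≈⟨ +-congˡ (+-congʳ (+-congʳ (distribʳ (u 1) (b 1) (b 0)))) ⟨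
    b 0 * u 0 + (((b 1 + b 0) * u 1 + X) + T) ∎
    where
    A = sum< (suc m) (λ i → b (suc i) * u (suc i))
    B = sum< (suc m) (λ i → b (suc i) * u (suc (suc i)))
    X = sum< m (λ j → (b (suc (suc j)) + b (suc j)) * u (suc (suc j)))
    T = b (suc m) * u (suc (suc m))

module Powers {n : ℕ} {c ℓ : Level} (F : GF2^ n c ℓ) where
  open GF2^ F
  open import Algebra.Properties.CommutativeSemigroup *-commutativeSemigroup
    using () renaming (interchange to *-interchange)

  pow-cong : ∀ {x y} k → x ≈ y → pow F x k ≈ pow F y k
  pow-cong zero    x≈y = refl
  pow-cong (suc k) x≈y = *-cong x≈y (pow-cong k x≈y)

  pow-+ : ∀ x a b → pow F x (a ℕ.+ b) ≈ pow F x a * pow F x b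
  pow-+ x zero    b = sym (*-identityˡ _)
  pow-+ x (suc a) b = trans (*-congˡ (pow-+ x a b)) (sym (*-assoc _ _ _))

  pow-distrib-* : ∀ x y k → pow F (x * y) k ≈ pow F x k * pow F y k
  pow-distrib-* x y zero    = sym (*-identityʳ 1#)
  pow-distrib-* x y (suc k) = trans (*-congˡ (pow-distrib-* x y k))
    (*-interchange x y (pow F x k) (pow F y k))

  pow-1# : ∀ k → pow F 1# k ≈ 1#
  pow-1# zero    = refl
  pow-1# (suc k) = trans (*-identityˡ _) (pow-1# k)

  pow-* : ∀ x a b → pow F x (a ℕ.* b) ≈ pow F (pow F x a) b
  pow-* x zero    b = sym (pow-1# b)
  pow-* x (suc a) b = trans (pow-+ x b (a ℕ.* b))
    (trans (*-congˡ (pow-* x a b)) (sym (pow-distrib-* x (pow F x a) b)))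

module CharacteristicTwo {n : ℕ} {c ℓ : Level} (F : GF2^ n c ℓ) where
  open GF2^ F
  open Sums commutativeSemiring
  open import Relation.Binary.Reasoning.Setoid setoid
  open import Algebra.Solver.CommutativeMonoid +-commutativeMonoid using (solve; _⊕_; _⊜_)
  open import Algebra.Properties.CommutativeSemigroup +-commutativeSemigroup
    using () renaming (x∙yz≈y∙xz to x+[y+z]≈y+[x+z])
  open Powers F
  open import Data.List using ([]; _∷_; _++_)

  x+x≈0 : ∀ x → x + x ≈ 0#
  x+x≈0 x = begin
    x + x             ≈⟨ +-cong (*-identityʳ x) (*-identityʳ x) ⟨
    x * 1# + x * 1#   ≈⟨ distribˡ x 1# 1# ⟨
    x * (1# + 1#)     ≈⟨ *-congˡ char2 ⟩
    x * 0#            ≈⟨ zeroʳ x ⟩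
    0#                ∎

  x+y+y≈x : ∀ x y → x + y + y ≈ x
  x+y+y≈x x y = trans (+-assoc x y y) (trans (+-congˡ (x+x≈0 y)) (+-identityʳ x))

  x+y≈z⇒x≈z+y : ∀ {x y z} → x + y ≈ z → x ≈ z + y
  x+y≈z⇒x≈z+y {x} {y} x+y≈z = trans (sym (x+y+y≈x x y)) (+-congʳ x+y≈z)

  x+[y+x]≈y : ∀ x y → x + (y + x) ≈ y
  x+[y+x]≈y x y = trans (+-comm x (y + x)) (x+y+y≈x y x)

  sum<-const-odd : ∀ K a → sum< (suc (K ℕ.+ K)) (λ _ → a) ≈ a
  sum<-const-odd K a = trans (+-congˡ (trans (sum<-const-+ K K a) (x+x≈0 _))) (+-identityʳ a)

  square-+ : ∀ x y → pow F (x + y) 2 ≈ pow F x 2 + pow F y 2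
  square-+ x y = begin
    (x + y) * ((x + y) * 1#)            ≈⟨ *-congˡ (*-identityʳ _) ⟩
    (x + y) * (x + y)                   ≈⟨ distribʳ _ x y ⟩
    x * (x + y) + y * (x + y)           ≈⟨ +-cong (distribˡ x x y) (distribˡ y x y) ⟩
    (x * x + x * y) + (y * x + y * y)   ≈⟨ +-congˡ (+-congʳ (*-comm y x)) ⟩
    (x * x + x * y) + (x * y + y * y)
      ≈⟨ solve 3 (λ a b d → (a ⊕ b) ⊕ (b ⊕ d) ⊜ (a ⊕ d) ⊕ (b ⊕ b)) refl (x * x) (x * y) (y * y) ⟩
    (x * x + y * y) + (x * y + x * y)   ≈⟨ +-congˡ (x+x≈0 _) ⟩
    (x * x + y * y) + 0#                ≈⟨ +-identityʳ _ ⟩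
    x * x + y * y                       ≈⟨ +-cong (*-congˡ (*-identityʳ x)) (*-congˡ (*-identityʳ y)) ⟨
    pow F x 2 + pow F y 2               ∎

  square-sum< : ∀ m f → pow F (sum< m f) 2 ≈ sum< m (λ j → pow F (f j) 2)
  square-sum< zero    f = zeroˡ _
  square-sum< (suc m) f = trans (square-+ _ _) (+-congˡ (square-sum< m (f ∘ suc)))

  frob-cong : ∀ {x y} i → x ≈ y → frob F x i ≈ frob F y i
  frob-cong i = pow-cong (2 ℕ.^ i)

  frob-zero : ∀ x → frob F x 0 ≈ x
  frob-zero = *-identityʳ

  frob-sucˡ : ∀ x i → frob F x (suc i) ≈ frob F (pow F x 2) i
  frob-sucˡ x i = pow-* x 2 (2 ℕ.^ i)

  frob-sucʳ : ∀ x i → frob F x (suc i) ≈ pow F (frob F x i) 2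
  frob-sucʳ x i =
    ≡.subst (λ k → pow F x k ≈ pow F (frob F x i) 2) (ℕₚ.*-comm (2 ℕ.^ i) 2) (pow-* x (2 ℕ.^ i) 2)

  frob-+ : ∀ x y i → frob F (x + y) i ≈ frob F x i + frob F y i
  frob-+ x y zero    = trans (frob-zero _) (sym (+-cong (frob-zero x) (frob-zero y)))
  frob-+ x y (suc i) = begin
    frob F (x + y) (suc i)                  ≈⟨ frob-sucʳ (x + y) i ⟩
    pow F (frob F (x + y) i) 2              ≈⟨ pow-cong 2 (frob-+ x y i) ⟩
    pow F (frob F x i + frob F y i) 2       ≈⟨ square-+ _ _ ⟩
    pow F (frob F x i) 2 + pow F (frob F y i) 2 ≈⟨ +-cong (frob-sucʳ x i) (frob-sucʳ y i) ⟨
    frob F x (suc i) + frob F y (suc i)     ∎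

  frob-* : ∀ x y i → frob F (x * y) i ≈ frob F x i * frob F y i
  frob-* x y i = pow-distrib-* x y (2 ℕ.^ i)

  frob-idempotent : ∀ {t} → pow F t 2 ≈ t → ∀ i → frob F t i ≈ t
  frob-idempotent t²≈t zero    = frob-zero _
  frob-idempotent t²≈t (suc i) =
    trans (frob-sucʳ _ i) (trans (pow-cong 2 (frob-idempotent t²≈t i)) t²≈t)

  bracket-++ : ∀ z xs ys → bracket F z (xs ++ ys) ≈ bracket F z xs + bracket F z ys
  bracket-++ z []       ys = sym (+-identityˡ _)
  bracket-++ z (x ∷ xs) ys = trans (+-congˡ (bracket-++ z xs ys)) (sym (+-assoc _ _ _))

  bracket-insert : ∀ z {x I J} → Inserts x I J → bracket F z J ≈ frob F z x + bracket F z I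
  bracket-insert z {x} (O , E , ≡.refl , ≡.refl) = begin
    bracket F z (O ++ x ∷ E)                       ≈⟨ bracket-++ z O (x ∷ E) ⟩
    bracket F z O + (frob F z x + bracket F z E)   ≈⟨ x+[y+z]≈y+[x+z] _ _ _ ⟩
    frob F z x + (bracket F z O + bracket F z E)   ≈⟨ +-congˡ (bracket-++ z O E) ⟨
    frob F z x + bracket F z (O ++ E)              ∎

module FiniteField {n : ℕ} {c ℓ : Level} (F : GF2^ n c ℓ) where
  open GF2^ F
  open Powers F
  open import Relation.Binary.Reasoning.Setoid setoid
  open import Algebra.Properties.CommutativeMonoid.Sum *-commutativeMonoid
    using () renaming (sum to product; sum-cong-≋ to product-cong; sum-remove to product-remove;
                       sum-permute to product-permute; ∑-distrib-+ to product-distrib-*)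
  open import Data.Fin using (punchIn)
  open import Data.Fin.Properties using (_≟_; punchInᵢ≢i)
  open import Data.Fin.Permutation using (permutation)
  open import Data.Bool using (if_then_else_)
  open import Data.Product using (proj₁; proj₂)

  product-const : ∀ m x → product {m} (λ _ → x) ≈ pow F x m
  product-const zero    x = refl
  product-const (suc m) x = *-congˡ (product-const m x)

  a*[b*y]≈y : ∀ {a b y} → a * b ≈ 1# → a * (b * y) ≈ y
  a*[b*y]≈y {a} {b} {y} ab≈1 = trans (sym (*-assoc a b y)) (trans (*-congʳ ab≈1) (*-identityˡ y))

  module Enumeration {N} (e : Fin (suc N) → Carrier) (e-injective : ∀ i j → e i ≈ e j → i ≡ j)
           (e-surjective : ∀ x → ∃ λ i → e i ≈ x) where

    index : Carrier → Fin (suc N)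
    index x = proj₁ (e-surjective x)

    e∘index : ∀ x → e (index x) ≈ x
    e∘index x = proj₂ (e-surjective x)

    i₀ : Fin (suc N)
    i₀ = index 0#

    ≈0⇒≡i₀ : ∀ {i} → e i ≈ 0# → i ≡ i₀
    ≈0⇒≡i₀ {i} ei≈0 = e-injective i i₀ (trans ei≈0 (sym (e∘index 0#)))

    -- Replacing 0 by 1 makes the product over all elements invertible; multiplication by an
    -- invertible x permutes the indices, and `correction` records the factor x picked up at 0.
    nonzero : Fin (suc N) → Carrier
    nonzero i = if does (i ≟ i₀) then 1# else e i

    nonzero⁻¹ : Fin (suc N) → Carrier
    nonzero⁻¹ i with i ≟ i₀
    ... | yes _   = 1#
    ... | no i≢i₀ = proj₁ (inverse (e i) (i≢i₀ ∘ ≈0⇒≡i₀))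

    nonzero-inverse : ∀ i → nonzero i * nonzero⁻¹ i ≈ 1#
    nonzero-inverse i with i ≟ i₀
    ... | yes _   = *-identityˡ 1#
    ... | no i≢i₀ = proj₂ (inverse (e i) (i≢i₀ ∘ ≈0⇒≡i₀))

    product-nonzero-invertible : product nonzero * product nonzero⁻¹ ≈ 1#
    product-nonzero-invertible = begin
      product nonzero * product nonzero⁻¹        ≈⟨ product-distrib-* nonzero nonzero⁻¹ ⟨
      product (λ i → nonzero i * nonzero⁻¹ i)    ≈⟨ product-cong nonzero-inverse ⟩
      product {suc N} (λ _ → 1#)                 ≈⟨ product-const (suc N) 1# ⟩
      pow F 1# (suc N)                           ≈⟨ pow-1# (suc N) ⟩
      1#                                         ∎

    module _ {x x⁻¹ : Carrier} (x*x⁻¹≈1 : x * x⁻¹ ≈ 1#) where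

      scale : Fin (suc N) → Fin (suc N)
      scale i = index (x * e i)

      unscale : Fin (suc N) → Fin (suc N)
      unscale i = index (x⁻¹ * e i)

      x⁻¹*x≈1 : x⁻¹ * x ≈ 1#
      x⁻¹*x≈1 = trans (*-comm x⁻¹ x) x*x⁻¹≈1

      scale∘unscale : ∀ i → scale (unscale i) ≡ i
      scale∘unscale i = e-injective _ _
        (trans (e∘index _) (trans (*-congˡ (e∘index _)) (a*[b*y]≈y x*x⁻¹≈1)))

      unscale∘scale : ∀ i → unscale (scale i) ≡ i
      unscale∘scale i = e-injective _ _
        (trans (e∘index _) (trans (*-congˡ (e∘index _)) (a*[b*y]≈y x⁻¹*x≈1)))

      correction : Fin (suc N) → Carrier
      correction i = if does (i ≟ i₀) then x else 1#

      scale-nonzero : ∀ i → x * nonzero i ≈ nonzero (scale i) * correction i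
      scale-nonzero i with i ≟ i₀ | scale i ≟ i₀
      ... | yes _     | yes _ = *-comm x 1#
      ... | yes ≡.refl | no si≢i₀ = contradiction (≈0⇒≡i₀ (trans (e∘index _)
                                     (trans (*-congˡ (e∘index 0#)) (zeroʳ x)))) si≢i₀
      ... | no i≢i₀  | yes si≡i₀ = contradiction (≈0⇒≡i₀ (trans (sym (a*[b*y]≈y x⁻¹*x≈1))
              (trans (*-congˡ xei≈0) (zeroʳ x⁻¹)))) i≢i₀
        where
        xei≈0 : x * e i ≈ 0#
        xei≈0 = trans (sym (e∘index _)) (trans (reflexive (≡.cong e si≡i₀)) (e∘index 0#))
      ... | no _     | no _ = trans (sym (e∘index _)) (sym (*-identityʳ _))

      product-correction : product correction ≈ x
      product-correction = begin
        product correction                                 ≈⟨ product-remove {i = i₀} correction ⟩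
        correction i₀ * product (correction ∘ punchIn i₀)  ≈⟨ *-cong correction-i₀ (product-cong rest) ⟩
        x * product {N} (λ _ → 1#)                         ≈⟨ *-congˡ (trans (product-const N 1#) (pow-1# N)) ⟩
        x * 1#                                             ≈⟨ *-identityʳ x ⟩
        x                                                  ∎
        where
        correction-i₀ : correction i₀ ≈ x
        correction-i₀ with i₀ ≟ i₀
        ... | yes _ = refl
        ... | no i₀≢i₀ = contradiction ≡.refl i₀≢i₀
        rest : ∀ j → correction (punchIn i₀ j) ≈ 1#
        rest j with punchIn i₀ j ≟ i₀
        ... | yes eq = contradiction eq (punchInᵢ≢i i₀ j)
        ... | no _   = refl

      pow-card-scaled : pow F x (suc N) * product nonzero ≈ product nonzero * x
      pow-card-scaled = begin
        pow F x (suc N) * product nonzero                 ≈⟨ *-congʳ (product-const (suc N) x) ⟨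
        product {suc N} (λ _ → x) * product nonzero        ≈⟨ product-distrib-* (λ _ → x) nonzero ⟨
        product (λ i → x * nonzero i)                      ≈⟨ product-cong scale-nonzero ⟩
        product (λ i → nonzero (scale i) * correction i)   ≈⟨ product-distrib-* (nonzero ∘ scale) correction ⟩
        product (nonzero ∘ scale) * product correction     ≈⟨ *-cong (sym (product-permute nonzero π)) product-correction ⟩
        product nonzero * x                                ∎
        where π = permutation scale unscale scale∘unscale unscale∘scale

      pow-card-invertible : pow F x (suc N) ≈ x
      pow-card-invertible = begin
        pow F x (suc N)                                ≈⟨ *-identityʳ _ ⟨
        pow F x (suc N) * 1#                           ≈⟨ *-congˡ product-nonzero-invertible ⟨
        pow F x (suc N) * (Π * Π⁻¹)                    ≈⟨ *-assoc _ _ _ ⟨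
        (pow F x (suc N) * Π) * Π⁻¹                    ≈⟨ *-congʳ (trans pow-card-scaled (*-comm _ x)) ⟩
        (x * Π) * Π⁻¹                                  ≈⟨ *-assoc _ _ _ ⟩
        x * (Π * Π⁻¹)                                  ≈⟨ *-congˡ product-nonzero-invertible ⟩
        x * 1#                                         ≈⟨ *-identityʳ x ⟩
        x                                              ∎
        where Π = product nonzero
              Π⁻¹ = product nonzero⁻¹

    pow-card-suc : ∀ x → pow F x (suc N) ≈ x
    pow-card-suc x with index x ≟ i₀
    ... | yes ix≡i₀ = trans (*-congʳ x≈0) (trans (zeroˡ _) (sym x≈0))
      where
      x≈0 : x ≈ 0#
      x≈0 = trans (sym (e∘index x)) (trans (reflexive (≡.cong e ix≡i₀)) (e∘index 0#))
    ... | no ix≢i₀ = pow-card-invertible (proj₂ (inverse x x≉0))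
      where
      x≉0 : ¬ x ≈ 0#
      x≉0 x≈0 = ix≢i₀ (≈0⇒≡i₀ (trans (e∘index x) x≈0))

  pow-card : ∀ {N} (e : Fin N → Carrier) → (∀ i j → e i ≈ e j → i ≡ j) →
             (∀ x → ∃ λ i → e i ≈ x) → ∀ x → pow F x N ≈ x
  pow-card {zero}  e _ e-surjective x with () ← proj₁ (e-surjective x)
  pow-card {suc N} e   = Enumeration.pow-card-suc e

  frob-n : ∀ x → frob F x n ≈ x
  frob-n = pow-card enum enum-injective enum-surjective

  leftInverse⇒rightInverse : ∀ {f g : Carrier → Carrier} →
    (∀ {x y} → x ≈ y → f x ≈ f y) → (∀ {x y} → x ≈ y → g x ≈ g y) →
    (∀ x → g (f x) ≈ x) → ∀ x → f (g x) ≈ x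
  leftInverse⇒rightInverse {f} {g} f-cong g-cong g∘f≈id x = begin
    f (g x)               ≈⟨ f-cong (g-cong y≈x) ⟨
    f (g (f (enum i)))    ≈⟨ f-cong (g∘f≈id (enum i)) ⟩
    f (enum i)            ≈⟨ y≈x ⟩
    x                     ∎
    where
    locate : Carrier → Fin (2 ℕ.^ n)
    locate y = proj₁ (enum-surjective y)
    enum∘locate : ∀ y → enum (locate y) ≈ y
    enum∘locate y = proj₂ (enum-surjective y)
    φ : Fin (2 ℕ.^ n) → Fin (2 ℕ.^ n)
    φ i = locate (f (enum i))
    φ-injective : ∀ {i j} → φ i ≡ φ j → i ≡ j
    φ-injective {i} {j} φi≡φj = enum-injective i j (begin
      enum i                     ≈⟨ g∘f≈id (enum i) ⟨
      g (f (enum i))             ≈⟨ g-cong (trans (sym (enum∘locate _))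
                                      (trans (reflexive (≡.cong enum φi≡φj)) (enum∘locate _))) ⟩
      g (f (enum j))             ≈⟨ g∘f≈id (enum j) ⟩
      enum j                     ∎)
    preimage = injective⇒surjective φ φ-injective (locate x)
    i = proj₁ preimage
    y≈x : f (enum i) ≈ x
    y≈x = trans (sym (enum∘locate _)) (trans (reflexive (≡.cong enum (proj₂ preimage))) (enum∘locate x))

module Inverse (K : ℕ) {c ℓ : Level} (F : GF2^ (suc (K ℕ.+ K)) c ℓ) (cinv : GF2^.Carrier F)
               (tr-cinv≈1 : GF2^._≈_ F (tr F cinv) (GF2^.1# F)) where
  open GF2^ F
  open Sums commutativeSemiring
  open Powers F
  open CharacteristicTwo F
  open FiniteField F using (frob-n; leftInverse⇒rightInverse)
  open import Relation.Binary.Reasoning.Setoid setoid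
  open import Algebra.Solver.CommutativeMonoid +-commutativeMonoid using (solve; _⊕_; _⊜_)
  open import Data.Nat using (_≤_)
  open import Data.Nat.Properties using (≤-refl; ≤-trans; n≤1+n; +-suc; +-mono-≤)
  open import Data.List using (_++_; [_])
  open import Data.List.Properties using (map-upTo)
  open import Data.Sum using (inj₁; inj₂)

  m : ℕ
  m = K ℕ.+ K

  b : ℕ → Carrier
  b i = bracket F cinv (bIndex (suc m) i)

  sumTo≡sum< : ∀ k f → sumTo F k f ≡ sum< k f
  sumTo≡sum< k f = ≡.cong (foldr _+_ 0#) (map-upTo f k)

  b-step : ∀ i → suc i ≤ m → b (suc i) + b i ≈ frob F cinv (suc i)
  b-step i i<m with bIndex-step m i i<m
  ... | inj₁ ins = trans (+-congʳ (bracket-insert cinv ins)) (x+y+y≈x _ _)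
  ... | inj₂ ins = trans (+-congˡ (bracket-insert cinv ins)) (x+[y+x]≈y _ _)

  evenPowers : ℕ → Carrier
  evenPowers L = sum< L (λ l → frob F cinv (2 ℕ.+ (l ℕ.+ l)))

  bracket-prog2 : ∀ L → bracket F cinv (prog 2 (L ℕ.+ L)) ≈ evenPowers L
  bracket-prog2 zero    = refl
  bracket-prog2 (suc L) = begin
    bracket F cinv (prog 2 (suc L ℕ.+ suc L))           ≡⟨ ≡.cong (bracket F cinv) (prog2-snoc L) ⟩
    bracket F cinv (prog 2 (L ℕ.+ L) ++ [ x ])          ≈⟨ bracket-++ cinv (prog 2 (L ℕ.+ L)) [ x ] ⟩
    bracket F cinv (prog 2 (L ℕ.+ L)) + (frob F cinv x + 0#) ≈⟨ +-cong (bracket-prog2 L) (+-identityʳ _) ⟩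
    evenPowers L + frob F cinv x                        ≈⟨ sum<-snoc L _ ⟨
    evenPowers (suc L)                                  ∎
    where x = 2 ℕ.+ (L ℕ.+ L)

  sum<-b-odd-length : ∀ L → L ≤ K → sum< (suc (L ℕ.+ L)) b ≈ b 0 + evenPowers L
  sum<-b-odd-length zero    _   = refl
  sum<-b-odd-length (suc L) L<K = begin
    sum< (suc (suc L ℕ.+ suc L)) b             ≡⟨ ≡.cong (λ k → sum< (suc (suc k)) b) (+-suc L L) ⟩
    sum< (suc (suc j)) b                       ≈⟨ trans (sum<-snoc (suc j) b) (+-congʳ (sum<-snoc j b)) ⟩
    (sum< j b + b j) + b (suc j)               ≈⟨ +-assoc _ _ _ ⟩
    sum< j b + (b j + b (suc j))               ≈⟨ +-cong (sum<-b-odd-length L (≤-trans (n≤1+n L) L<K))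
                                                         (trans (+-comm _ _) (b-step j j<m)) ⟩
    (b 0 + evenPowers L) + frob F cinv (suc j) ≈⟨ +-assoc _ _ _ ⟩
    b 0 + (evenPowers L + frob F cinv (suc j)) ≈⟨ +-congˡ (sum<-snoc L _) ⟨
    b 0 + evenPowers (suc L)                   ∎
    where
    j = suc (L ℕ.+ L)
    j<m : suc j ≤ m
    j<m = ≡.subst (_≤ m) (≡.cong suc (+-suc L L)) (+-mono-≤ L<K L<K)

  sum<-b≈0 : sum< (suc m) b ≈ 0#
  sum<-b≈0 = trans (sum<-b-odd-length K ≤-refl) (trans (+-congˡ (sym (bracket-prog2 K))) (x+x≈0 _))

  b-telescope : ∀ k → k ≤ m → b k ≈ b 0 + sum< k (λ j → frob F cinv (suc j))
  b-telescope zero    _   = sym (+-identityʳ _)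
  b-telescope (suc k) k<m = begin
    b (suc k)                                          ≈⟨ x+y≈z⇒x≈z+y (b-step k k<m) ⟩
    frob F cinv (suc k) + b k                          ≈⟨ +-comm _ _ ⟩
    b k + frob F cinv (suc k)                          ≈⟨ +-congʳ (b-telescope k (≤-trans (n≤1+n k) k<m)) ⟩
    (b 0 + sum< k (λ j → frob F cinv (suc j))) + frob F cinv (suc k) ≈⟨ +-assoc _ _ _ ⟩
    b 0 + (sum< k (λ j → frob F cinv (suc j)) + frob F cinv (suc k)) ≈⟨ +-congˡ (sum<-snoc k _) ⟨
    b 0 + sum< (suc k) (λ j → frob F cinv (suc j))     ∎

  b-last+b-first : b m + b 0 ≈ 1# + cinv
  b-last+b-first = begin
    b m + b 0                   ≈⟨ +-congʳ (b-telescope m ≤-refl) ⟩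
    (b 0 + S) + b 0             ≈⟨ +-congʳ (+-comm _ _) ⟩
    (S + b 0) + b 0             ≈⟨ x+y+y≈x S (b 0) ⟩
    S                           ≈⟨ x+y≈z⇒x≈z+y (trans (+-comm S _) tr≈1) ⟩
    1# + frob F cinv 0          ≈⟨ +-congˡ (frob-zero cinv) ⟩
    1# + cinv                   ∎
    where
    S = sum< m (λ j → frob F cinv (suc j))
    tr≈1 : frob F cinv 0 + S ≈ 1#
    tr≈1 = trans (reflexive (≡.sym (sumTo≡sum< (suc m) (frob F cinv)))) tr-cinv≈1

  Tr : Carrier → Carrier
  Tr y = sum< (suc m) (frob F y)

  B : Carrier → Carrier
  B y = sum< (suc m) (λ i → b i * frob F y i)

  tr≡Tr : ∀ y → tr F y ≡ Tr y
  tr≡Tr y = sumTo≡sum< (suc m) (frob F y)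

  linPoly≡B : ∀ y → linPoly F b y ≡ B y
  linPoly≡B y = sumTo≡sum< (suc m) (λ i → b i * frob F y i)

  Tr-cong : ∀ {x y} → x ≈ y → Tr x ≈ Tr y
  Tr-cong x≈y = sum<-cong (suc m) (λ i → frob-cong i x≈y)

  B-cong : ∀ {x y} → x ≈ y → B x ≈ B y
  B-cong x≈y = sum<-cong (suc m) (λ i → *-congˡ {b i} (frob-cong i x≈y))

  Tr-+ : ∀ x y → Tr (x + y) ≈ Tr x + Tr y
  Tr-+ x y = trans (sum<-cong (suc m) (frob-+ x y)) (sum<-+ (suc m) (frob F x) (frob F y))

  B-+ : ∀ x y → B (x + y) ≈ B x + B y
  B-+ x y = trans (sum<-cong (suc m) (λ i → trans (*-congˡ (frob-+ x y i)) (distribˡ (b i) _ _)))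
                  (sum<-+ (suc m) (λ i → b i * frob F x i) (λ i → b i * frob F y i))

  Tr-shift : ∀ y → sum< (suc m) (λ i → frob F y (suc i)) ≈ Tr y
  Tr-shift y = begin
    sum< (suc m) (λ i → frob F y (suc i))   ≈⟨ x+y≈z⇒x≈z+y rotate ⟩
    (Tr y + y) + frob F y 0                ≈⟨ +-congˡ (frob-zero y) ⟩
    (Tr y + y) + y                         ≈⟨ x+y+y≈x (Tr y) y ⟩
    Tr y                                   ∎
    where
    rotate : sum< (suc m) (λ i → frob F y (suc i)) + frob F y 0 ≈ Tr y + y
    rotate = trans (+-comm _ _) (trans (sum<-snoc (suc m) (frob F y)) (+-congˡ (frob-n y)))

  Tr-square : ∀ y → Tr (pow F y 2) ≈ Tr y
  Tr-square y = trans (sum<-cong (suc m) (λ i → sym (frob-sucˡ y i))) (Tr-shift y)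

  square-Tr : ∀ y → pow F (Tr y) 2 ≈ Tr y
  square-Tr y = trans (square-sum< (suc m) (frob F y))
                      (trans (sum<-cong (suc m) (λ i → sym (frob-sucʳ y i))) (Tr-shift y))

  Tr-idempotent : ∀ {t} → pow F t 2 ≈ t → Tr t ≈ t
  Tr-idempotent {t} t²≈t = trans (sum<-cong (suc m) (frob-idempotent t²≈t)) (sum<-const-odd K t)

  B-idempotent : ∀ {t} → pow F t 2 ≈ t → B t ≈ 0#
  B-idempotent {t} t²≈t = begin
    B t                         ≈⟨ sum<-cong (suc m) (λ i → *-congˡ {b i} (frob-idempotent t²≈t i)) ⟩
    sum< (suc m) (λ i → b i * t) ≈⟨ sum<-*ʳ (suc m) b t ⟩
    sum< (suc m) b * t          ≈⟨ *-congʳ sum<-b≈0 ⟩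
    0# * t                      ≈⟨ zeroˡ t ⟩
    0#                          ∎

  Tr-*cinv : ∀ y → Tr (y * cinv) ≈ cinv * y + sum< m (λ j → frob F cinv (suc j) * frob F y (suc j))
  Tr-*cinv y = +-cong (trans (frob-zero _) (*-comm y cinv))
                      (sum<-cong m (λ j → trans (frob-* y cinv (suc j)) (*-comm _ _)))

  B+B∘square : ∀ y → B y + B (pow F y 2) ≈ y + Tr (y * cinv)
  B+B∘square y = begin
    B y + B (pow F y 2)
      ≈⟨ +-congˡ (sum<-cong (suc m) (λ i → *-congˡ {b i} (sym (frob-sucˡ y i)))) ⟩
    B y + sum< (suc m) (λ i → b i * frob F y (suc i))
      ≈⟨ sum<-pair-shift m b (frob F y) ⟩
    b 0 * frob F y 0 + (sum< m (λ j → (b (suc j) + b j) * frob F y (suc j)) + b m * frob F y (suc m))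
      ≈⟨ +-cong (*-congˡ (frob-zero y))
                (+-cong (sum<-cong< m (λ j j<m → *-congʳ (b-step j j<m))) (*-congˡ (frob-n y))) ⟩
    b 0 * y + (Z + b m * y)
      ≈⟨ solve 3 (λ p z q → p ⊕ (z ⊕ q) ⊜ (q ⊕ p) ⊕ z) refl _ Z _ ⟩
    (b m * y + b 0 * y) + Z       ≈⟨ +-congʳ (distribʳ y (b m) (b 0)) ⟨
    (b m + b 0) * y + Z           ≈⟨ +-congʳ (*-congʳ b-last+b-first) ⟩
    (1# + cinv) * y + Z           ≈⟨ +-congʳ (trans (distribʳ y 1# cinv) (+-congʳ (*-identityˡ y))) ⟩
    (y + cinv * y) + Z            ≈⟨ +-assoc _ _ _ ⟩
    y + (cinv * y + Z)            ≈⟨ +-congˡ (Tr-*cinv y) ⟨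
    y + Tr (y * cinv)             ∎
    where Z = sum< m (λ j → frob F cinv (suc j) * frob F y (suc j))

  P Q : Carrier → Carrier
  P x = x + pow F x 2 + tr F (x * cinv)
  Q x = linPoly F b x + tr F x

  P-cong : ∀ {x y} → x ≈ y → P x ≈ P y
  P-cong {x} {y} x≈y = +-cong (+-cong x≈y (pow-cong 2 x≈y))
    (trans (reflexive (tr≡Tr _)) (trans (Tr-cong (*-congʳ x≈y)) (reflexive (≡.sym (tr≡Tr _)))))

  Q-cong : ∀ {x y} → x ≈ y → Q x ≈ Q y
  Q-cong {x} {y} x≈y = begin
    Q x           ≡⟨ ≡.cong₂ _+_ (linPoly≡B x) (tr≡Tr x) ⟩
    B x + Tr x    ≈⟨ +-cong (B-cong x≈y) (Tr-cong x≈y) ⟩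
    B y + Tr y    ≡⟨ ≡.cong₂ _+_ (linPoly≡B y) (tr≡Tr y) ⟨
    Q y           ∎

  Q∘P≈id : ∀ y → Q (P y) ≈ y
  Q∘P≈id y = begin
    Q (P y)                                 ≡⟨ ≡.cong₂ _+_ (linPoly≡B (P y)) (tr≡Tr (P y)) ⟩
    B (P y) + Tr (P y)                      ≡⟨ ≡.cong (λ z → B z + Tr z) (≡.cong (y + pow F y 2 +_) (tr≡Tr _)) ⟩
    B (y + y² + t) + Tr (y + y² + t)
      ≈⟨ +-cong (trans (B-+ _ t) (+-congʳ (B-+ y y²))) (trans (Tr-+ _ t) (+-congʳ (Tr-+ y y²))) ⟩
    (B y + B y² + B t) + (Tr y + Tr y² + Tr t)
      ≈⟨ +-cong (+-cong (B+B∘square y) (B-idempotent t²≈t))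
                (+-cong (trans (+-congˡ (Tr-square y)) (x+x≈0 _)) (Tr-idempotent t²≈t)) ⟩
    (y + t + 0#) + (0# + t)                 ≈⟨ +-cong (+-identityʳ _) (+-identityˡ t) ⟩
    y + t + t                               ≈⟨ x+y+y≈x y t ⟩
    y                                       ∎
    where
    y² = pow F y 2
    t = Tr (y * cinv)
    t²≈t : pow F t 2 ≈ t
    t²≈t = square-Tr (y * cinv)

  P∘Q≈id : ∀ x → P (Q x) ≈ x
  P∘Q≈id = leftInverse⇒rightInverse P-cong Q-cong Q∘P≈id

theorem2 : ∀ {c ℓ : Level} (n : ℕ) → n % 2 ≡ 1 → (F : GF2^ n c ℓ) →
    let open GF2^ F in
    (a cinv : Carrier) → a * cinv ≈ 1# → tr F cinv ≈ 1# →
    let P = λ x → x + pow F x 2 + tr F (x * cinv)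
        Q = λ x → linPoly F (λ i → bracket F cinv (bIndex n i)) x + tr F x
    in (∀ x → P (Q x) ≈ x) × (∀ x → Q (P x) ≈ x)
theorem2 n n-odd F _ cinv _ tr-cinv≈1 with odd⇒≡1+K+K n n-odd
... | K , ≡.refl = P∘Q≈id , Q∘P≈id
  where open Inverse K F cinv tr-cinv≈1
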